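{- Let $\Gamma$ be a graph, let $\mathbb{T}_1=(\Delta_1,\iota_1,\Theta_1)$ and $\mathbb{T}_2=(\Delta_2,\iota_2,\Theta_2)$ be finite graph-types, and let $e:\Delta_2\hookrightarrow\Theta_1$ be an embedding. Then $\Gamma$ is $(\mathbb{T}_1\oplus_e\mathbb{T}_2)$-regular provided that (1) $\Gamma$ is $\mathbb{T}_1$-regular, (2) $\Gamma$ is $\mathbb{T}_2$-regular, and (3) $\Gamma$ is $\mathbb{T}$-regular for every graph-type $\mathbb{T}\prec\mathbb{T}_1\oplus_e\mathbb{T}_2$.
   Context: Graphs are finite simple graphs; homomorphisms map edges to edges; an embedding is an injective map preserving edges and non-edges. A graph-type is a triple $(\Delta,\iota,\Theta)$ with graphs $\Delta,\Theta$ and an embedding $\iota:\Delta\hookrightarrow\Theta$. A morphism $(\Delta_1,\iota_1,\Theta_1)\to(\Delta_2,\iota_2,\Theta_2)$ is a pair of homomorphisms $f:\Delta_1\to\Delta_2$, $g:\Theta_1\to\Theta_2$ with $g\circ\iota_1=\iota_2\circ f$; isomorphisms of graph-types are morphisms with $f,g$ isomorphisms. Write $\mathbb{T}\preceq\mathbb{T}'$ if there is a morphism $(f,g):\mathbb{T}'\to\mathbb{T}$ with $f$ an isomorphism and $g$ surjective on vertices; write $\mathbb{T}\prec\mathbb{T}'$ if moreover such $g$ is not an isomorphism. For a graph-type $\mathbb{T}=(\Delta,\iota,\Theta)$, a graph $\Gamma$ and an embedding $\kappa:\Delta\hookrightarrow\Gamma$, let $\#(\Gamma,\mathbb{T},\kappa)$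 be the number of embeddings $\hat\kappa:\Theta\hookrightarrow\Gamma$ with $\hat\kappa\circ\iota=\kappa$. $\Gamma$ is $\mathbb{T}$-regular if $\#(\Gamma,\mathbb{T},\kappa)$ does not depend on the embedding $\kappa$. Free sum: given $\mathbb{T}_1,\mathbb{T}_2,e$ as in the claim, let $\Lambda$ be the graph obtained from the disjoint union of $\Theta_1$ and $\Theta_2$ by identifying $e(v)$ with $\iota_2(v)$ for each $v\in V(\Delta_2)$ (edges are the images of the edges of $\Theta_1$ and $\Theta_2$; i.e. $\Lambda$ with the induced maps $\lambda_1:\Theta_1\hookrightarrow\Lambda$, $\lambda_2:\Theta_2\hookrightarrow\Lambda$ is the pushout of $e$ and $\iota_2$ in the category of graphs). Then $\mathbb{T}_1\oplus_e\mathbb{T}_2:=(\Delta_1,\lambda_1\circ\iota_1,\Lambda)$. -}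

module Defs where

open import Data.Nat using (ℕ; zero; suc)
open import Data.Fin using (Fin; _≟_)
open import Data.Fin.Properties using (all?)
open import Data.Bool using (Bool; true; false)
import Data.Bool.Properties as BoolP
open import Data.List using (List; []; _∷_; [_]; concatMap; map; length; filter; allFin)
open import Data.Vec using (Vec; lookup) renaming ([] to []ᵥ; _∷_ to _∷ᵥ_)
open import Data.Product using (Σ; ∃; ∃-syntax; _×_; _,_; proj₁; proj₂)
open import Data.Sum using (_⊎_)
open import Relation.Nullary using (¬_; Dec; yes; no)
open import Relation.Nullary.Decidable using (_×-dec_; _→-dec_; map′)
open import Relation.Binary.PropositionalEquality using (_≡_; refl; trans; cong)
open import Function using (_∘_; _⇔_)

record Graph : Set where
  field
    size   : ℕ
    adj    : Fin size → Fin size → Bool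
    sym    : ∀ x y → adj x y ≡ adj y x
    irrefl : ∀ x → adj x x ≡ false
open Graph public

V : Graph → Set
V G = Fin (size G)

Edge : (G : Graph) → V G → V G → Set
Edge G x y = adj G x y ≡ true

Injective : {A B : Set} → (A → B) → Set
Injective f = ∀ x y → f x ≡ f y → x ≡ y

Surjective : {A B : Set} → (A → B) → Set
Surjective f = ∀ y → ∃[ x ] f x ≡ y

IsHom : (G H : Graph) → (V G → V H) → Set
IsHom G H f = ∀ x y → Edge G x y → Edge H (f x) (f y)

IsEmb : (G H : Graph) → (V G → V H) → Set
IsEmb G H f = Injective f × (∀ x y → adj H (f x) (f y) ≡ adj G x y)

IsIso : (G H : Graph) → (V G → V H) → Set
IsIso G H f = IsEmb G H f × Surjective f

record Emb (G H : Graph) : Set where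
  constructor mkEmb
  field
    fun   : V G → V H
    isEmb : IsEmb G H fun
open Emb public

_∘E_ : {G H K : Graph} → Emb H K → Emb G H → Emb G K
_∘E_ {G} {H} {K} g f = mkEmb (fun g ∘ fun f) (inj , pres)
  where
  inj : Injective (fun g ∘ fun f)
  inj x y eq = proj₁ (isEmb f) x y (proj₁ (isEmb g) (fun f x) (fun f y) eq)
  pres : ∀ x y → adj K (fun g (fun f x)) (fun g (fun f y)) ≡ adj G x y
  pres x y = trans (proj₂ (isEmb g) (fun f x) (fun f y)) (proj₂ (isEmb f) x y)

record GraphType : Set where
  constructor mkType
  field
    Δ : Graph
    Θ : Graph
    ι : Emb Δ Θ
open GraphType public

record Morphism (T₁ T₂ : GraphType) : Set where
  field
    f    : V (Δ T₁) → V (Δ T₂)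
    g    : V (Θ T₁) → V (Θ T₂)
    fHom : IsHom (Δ T₁) (Δ T₂) f
    gHom : IsHom (Θ T₁) (Θ T₂) g
    comm : ∀ v → g (fun (ι T₁) v) ≡ fun (ι T₂) (f v)
open Morphism public

_⪯_ : GraphType → GraphType → Set
T ⪯ T' = Σ (Morphism T' T) λ m → IsIso (Δ T') (Δ T) (f m) × Surjective (g m)

_≺_ : GraphType → GraphType → Set
T ≺ T' = (T ⪯ T') ×
  ¬ (Σ (Morphism T' T) λ m → IsIso (Δ T') (Δ T) (f m) × IsIso (Θ T') (Θ T) (g m))

-- all vectors of length n over Fin m (i.e. all maps Fin n → Fin m)
allVecs : (n m : ℕ) → List (Vec (Fin m) n)
allVecs zero    m = [ []ᵥ ]
allVecs (suc n) m = concatMap (λ v → map (_∷ᵥ v) (allFin m)) (allVecs n m)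

injective? : ∀ {n m} (h : Fin n → Fin m) → Dec (Injective h)
injective? h = all? λ x → all? λ y → (h x ≟ h y) →-dec (x ≟ y)

isEmb? : (G H : Graph) (h : V G → V H) → Dec (IsEmb G H h)
isEmb? G H h = injective? h ×-dec
  (all? λ x → all? λ y → adj H (h x) (h y) BoolP.≟ adj G x y)

Extends : (Γ : Graph) (T : GraphType) (κ : Emb (Δ T) Γ) → (V (Θ T) → V Γ) → Set
Extends Γ T κ h = IsEmb (Θ T) Γ h × (∀ v → h (fun (ι T) v) ≡ fun κ v)

extends? : (Γ : Graph) (T : GraphType) (κ : Emb (Δ T) Γ) (h : V (Θ T) → V Γ) →
           Dec (Extends Γ T κ h)
extends? Γ T κ h = isEmb? (Θ T) Γ h ×-dec all? (λ v → h (fun (ι T) v) ≟ fun κ v)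

count : (Γ : Graph) (T : GraphType) → Emb (Δ T) Γ → ℕ
count Γ T κ =
  length (filter (λ v → extends? Γ T κ (lookup v)) (allVecs (size (Θ T)) (size Γ)))

Regular : Graph → GraphType → Set
Regular Γ T = ∀ (κ κ' : Emb (Δ T) Γ) → count Γ T κ ≡ count Γ T κ'

-- Free sum: Λ with λ₁ : Θ₁ ↪ Λ, λ₂ : Θ₂ ↪ Λ is the graph obtained from the
-- disjoint union of Θ₁ and Θ₂ by identifying e(v) with ι₂(v) (v ∈ Δ₂),
-- with edges the images of the edges of Θ₁ and Θ₂.

record IsFreeSum (T₁ T₂ : GraphType) (e : Emb (Δ T₂) (Θ T₁))
                 (Λ : Graph) (λ₁ : Emb (Θ T₁) Λ) (λ₂ : Emb (Θ T₂) Λ) : Set where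
  field
    glue     : ∀ v → fun λ₁ (fun e v) ≡ fun λ₂ (fun (ι T₂) v)
    glueOnly : ∀ x y → fun λ₁ x ≡ fun λ₂ y →
               ∃[ v ] (x ≡ fun e v × y ≡ fun (ι T₂) v)
    covers   : ∀ z → (∃[ x ] fun λ₁ x ≡ z) ⊎ (∃[ y ] fun λ₂ y ≡ z)
    edges    : ∀ a b → Edge Λ a b ⇔
               ((∃[ x ] ∃[ x' ] (Edge (Θ T₁) x x' × fun λ₁ x ≡ a × fun λ₁ x' ≡ b))
                ⊎ (∃[ y ] ∃[ y' ] (Edge (Θ T₂) y y' × fun λ₂ y ≡ a × fun λ₂ y' ≡ b)))

freeSumType : (T₁ : GraphType) (Λ : Graph) → Emb (Θ T₁) Λ → GraphType
freeSumType T₁ Λ λ₁ = mkType (Δ T₁) Λ (λ₁ ∘E ι T₁)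

-- Count the maps g : Λ → Γ whose restrictions to Θ₁ and Θ₂ are embeddings, the first one
-- extending κ ("gluings"). Λ being a pushout, a gluing is the same as an extension h of κ
-- along T₁ together with an extension of h ∘ e along T₂, so by (1) and (2) the number of
-- gluings does not depend on κ. The gluings that are embeddings are the extensions along
-- T₁ ⊕ₑ T₂; the others are sorted by their profile (which points they identify and which
-- they send to edges). A non-embedding g₀ factors through its image, which carries a graph-type
-- T₀ ≺ T₁ ⊕ₑ T₂ (strictly, since a vertex-surjective homomorphism onto an isomorphic finite
-- graph is an embedding), and the gluings with the profile of g₀ are the extensions along T₀,
-- so by (3) their number does not depend on κ either. Cancelling leaves the extensions along
-- T₁ ⊕ₑ T₂.

module Submission where

open import Data.Bool using (Bool; true; false)
import Data.Bool as Bool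
open import Data.Bool.Properties using (⇔→≡)
open import Data.Empty using (⊥-elim; ⊥-elim-irr)
open import Data.Fin using (Fin; zero; suc; _≟_; punchOut)
open import Data.Fin.Permutation using (↔⇒≡)
open import Data.Fin.Properties using (¬Fin0; any?; injective⇒≤; punchOut-injective; +↔⊎)
open import Data.Irrelevant as Irrelevant using (Irrelevant; [_])
open import Data.List using (List; []; _∷_; length; filter)
import Data.List as List
open import Data.List.Properties using (map-tabulate; map-++; map-cong; map-∘)
open import Data.Nat using (ℕ; zero; suc; _+_)
open import Data.Nat.ListAction using (sum)
open import Data.Nat.ListAction.Properties using (sum-++)
open import Data.Nat.Properties using (+-cancelʳ-≡; +-identityʳ; <-irrefl)
open import Data.Product using (Σ; ∃-syntax; _×_; _,_; proj₁; proj₂)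
open import Data.Product.Function.Dependent.Propositional using (Σ-↔)
import Data.Product.Properties as Product
open import Data.Refinement using (Refinement-syntax; _,_; value; refine; value-injective)
open import Data.Sum using (_⊎_; inj₁; inj₂)
open import Data.Sum.Function.Propositional using (_⊎-↔_)
open import Data.Vec using (Vec; []; _∷_; lookup; tabulate)
import Data.Vec.Properties as Vec
open import Data.Vec.Properties using (lookup∘tabulate; tabulate∘lookup; tabulate-cong)
open import Function using (_∘_; id; _↔_; mk↔ₛ′; mk⇔; Inverse; Equivalence; Injection)
open import Function.Properties.Inverse using (↔-refl; ↔-sym; ↔-trans; ↔⇒↣)
import Function.Related.Propositional as Related
open import Level using (0ℓ)
open import Relation.Binary.Definitions using (DecidableEquality)
open import Relation.Binary.PropositionalEquality
  using (_≡_; _≗_; refl; sym; trans; cong; cong₂; subst₂)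
open import Relation.Nullary using (¬_; Dec; yes; no; does)
open import Relation.Nullary.Decidable using (_×-dec_; ¬?; recompute)
open import Relation.Unary using (Pred; Decidable)

open import Defs hiding (sym)

private
  variable
    A B C : Set
    m n s : ℕ

Fin-cong : m ≡ n → Fin m ↔ Fin n
Fin-cong refl = ↔-refl

to-injective : (φ : A ↔ B) → ∀ {x y} → Inverse.to φ x ≡ Inverse.to φ y → x ≡ y
to-injective φ = Injection.injective (↔⇒↣ φ)

from-injective : (φ : A ↔ B) → ∀ {x y} → Inverse.from φ x ≡ Inverse.from φ y → x ≡ y
from-injective φ = to-injective (↔-sym φ)

Finite : Set → Set
Finite A = ∃[ k ] A ↔ Fin k

-- xs lists every element of A exactly once, stated as the only consequence that is used:
-- summing weights over xs counts any Σ-type whose fibres have those sizes.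
record Enumeration {A : Set} (xs : List A) : Set₁ where
  constructor enumeration
  field
    Σ↔sum : {B : A → Set} (w : A → ℕ) → (∀ a → B a ↔ Fin (w a)) →
            Σ A B ↔ Fin (sum (List.map w xs))
open Enumeration

Σ-Fin↔sum : {B : Fin n → Set} (w : Fin n → ℕ) → (∀ i → B i ↔ Fin (w i)) →
            Σ (Fin n) B ↔ Fin (sum (List.tabulate w))
Σ-Fin↔sum {zero}      w B↔ = mk↔ₛ′ (λ ()) (λ ()) (λ ()) (λ ())
Σ-Fin↔sum {suc n} {B} w B↔ =
  ↔-trans split (↔-trans (B↔ zero ⊎-↔ Σ-Fin↔sum (w ∘ suc) (B↔ ∘ suc)) (↔-sym +↔⊎))
  where
  split : Σ (Fin (suc n)) B ↔ (B zero ⊎ Σ (Fin n) (B ∘ suc))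
  split = mk↔ₛ′ (λ { (zero , b) → inj₁ b ; (suc i , b) → inj₂ (i , b) })
                (λ { (inj₁ b) → zero , b ; (inj₂ (i , b)) → suc i , b })
                (λ { (inj₁ _) → refl ; (inj₂ _) → refl })
                (λ { (zero , _) → refl ; (suc _ , _) → refl })

allFin-enumeration : ∀ n → Enumeration (List.allFin n)
allFin-enumeration n = enumeration λ w B↔ →
  ↔-trans (Σ-Fin↔sum w B↔) (Fin-cong (cong sum (sym (map-tabulate id w))))

sum-map-concatMap : (w : B → ℕ) (f : A → List B) (xs : List A) →
  sum (List.map w (List.concatMap f xs)) ≡ sum (List.map (λ x → sum (List.map w (f x))) xs)
sum-map-concatMap w f []       = refl
sum-map-concatMap w f (x ∷ xs) =
  trans (cong sum (map-++ w (f x) (List.concatMap f xs)))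
        (trans (sum-++ (List.map w (f x)) _) (cong (sum (List.map w (f x)) +_) (sum-map-concatMap w f xs)))

allVecs-enumeration : ∀ s m → Enumeration (allVecs s m)
allVecs-enumeration zero m = enumeration λ {B} w B↔ →
  ↔-trans (mk↔ₛ′ (λ { ([] , b) → b }) ([] ,_) (λ _ → refl) (λ { ([] , _) → refl }))
          (↔-trans (B↔ []) (Fin-cong (sym (+-identityʳ (w [])))))
allVecs-enumeration (suc s) m = enumeration Σ↔sum-cons
  where
  Σ↔sum-cons : {B : Vec (Fin m) (suc s) → Set} (w : Vec (Fin m) (suc s) → ℕ) →
               (∀ v → B v ↔ Fin (w v)) → Σ _ B ↔ Fin (sum (List.map w (allVecs (suc s) m)))
  Σ↔sum-cons {B} w B↔ =
    ↔-trans uncons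
      (↔-trans (Σ↔sum (allVecs-enumeration s m)
                       (λ v → sum (List.map (w ∘ (_∷ v)) (List.allFin m)))
                       (λ v → Σ↔sum (allFin-enumeration m) (w ∘ (_∷ v)) (B↔ ∘ (_∷ v))))
               (Fin-cong (sym (trans (sum-map-concatMap w _ (allVecs s m))
                                     (cong sum (map-cong (λ v → cong sum (sym (map-∘ (List.allFin m))))
                                                         (allVecs s m)))))))
    where
    uncons : Σ (Vec (Fin m) (suc s)) B ↔ Σ (Vec (Fin m) s) (λ v → Σ (Fin m) (λ i → B (i ∷ v)))
    uncons = mk↔ₛ′ (λ { (i ∷ v , b) → v , i , b }) (λ (v , i , b) → i ∷ v , b)
                   (λ _ → refl) (λ { (_ ∷ _ , _) → refl })

inhabited? : A ↔ Fin n → Dec A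
inhabited? {n = zero}  φ = no (¬Fin0 ∘ Inverse.to φ)
inhabited? {n = suc n} φ = yes (Inverse.from φ zero)

↔-by-witness : Dec A → Dec B → (A ⊎ B → A ↔ B) → A ↔ B
↔-by-witness (yes a) _       φ = φ (inj₁ a)
↔-by-witness (no _)  (yes b) φ = φ (inj₂ b)
↔-by-witness (no ¬a) (no ¬b) _ =
  mk↔ₛ′ (⊥-elim ∘ ¬a) (⊥-elim ∘ ¬b) (λ b → ⊥-elim (¬b b)) (λ a → ⊥-elim (¬a a))

⊎-cancelʳ-Fin : (Fin m ⊎ C) ↔ (Fin n ⊎ C) → Finite C → m ≡ n
⊎-cancelʳ-Fin {m} {n = n} φ (r , C↔) = +-cancelʳ-≡ r m n (↔⇒≡ (begin
  Fin (m + r)     ↔⟨ +↔⊎ ⟩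
  (Fin m ⊎ Fin r) ↔⟨ ↔-refl ⊎-↔ C↔ ⟨
  (Fin m ⊎ _)     ↔⟨ φ ⟩
  (Fin n ⊎ _)     ↔⟨ ↔-refl ⊎-↔ C↔ ⟩
  (Fin n ⊎ Fin r) ↔⟨ +↔⊎ ⟨
  Fin (n + r)     ∎))
  where open Related.EquationalReasoning

Fin-injective⇒surjective : (f : Fin n → Fin n) → Injective f → Surjective f
Fin-injective⇒surjective {zero}  f inj ()
Fin-injective⇒surjective {suc n} f inj y with any? (λ x → f x ≟ y)
... | yes hit  = hit
... | no  miss = ⊥-elim (<-irrefl refl (injective⇒≤ squeeze-injective))
  where
  squeeze : Fin (suc n) → Fin n
  squeeze x = punchOut {i = y} {j = f x} (λ y≡fx → miss (x , sym y≡fx))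
  squeeze-injective : ∀ {x x'} → squeeze x ≡ squeeze x' → x ≡ x'
  squeeze-injective {x} {x'} eq = inj x x' (punchOut-injective {i = y} _ _ eq)

Fin-surjective⇒injective : (f : Fin n → Fin n) → Surjective f → Injective f
Fin-surjective⇒injective f surj x x' fx≡fx' =
  trans (sym (section∘f x)) (trans (cong section fx≡fx') (section∘f x'))
  where
  section = proj₁ ∘ surj
  section-injective : Injective section
  section-injective y y' eq = trans (sym (proj₂ (surj y))) (trans (cong f eq) (proj₂ (surj y')))
  section∘f : ∀ x → section (f x) ≡ x
  section∘f x with Fin-injective⇒surjective section section-injective x
  ... | y , refl = cong section (proj₂ (surj y))

injective⇒surjective : Finite A → (f : A → A) → Injective f → Surjective f
injective⇒surjective (_ , φ) f inj y
  with Fin-injective⇒surjective (Inverse.to φ ∘ f ∘ Inverse.from φ)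
         (λ i j eq → from-injective φ (inj _ _ (to-injective φ eq))) (Inverse.to φ y)
... | i , eq = Inverse.from φ i , to-injective φ eq

witness : {P : Pred A 0ℓ} → Decidable P → (r : [ a ∈ A ∣ P a ]) → P (value r)
witness P? (a , [ p ]) = recompute (P? a) p

length-filter≡sum : {P : Pred A 0ℓ} (P? : Decidable P) (xs : List A) →
  length (filter P? xs) ≡ sum (List.map (λ x → length (filter P? (x ∷ []))) xs)
length-filter≡sum P? []       = refl
length-filter≡sum P? (x ∷ xs) with does (P? x)
... | true  = cong suc (length-filter≡sum P? xs)
... | false = length-filter≡sum P? xs

Irrelevant↔length-filter : {P : Pred A 0ℓ} (P? : Decidable P) (x : A) →
  Irrelevant (P x) ↔ Fin (length (filter P? (x ∷ [])))
Irrelevant↔length-filter P? x with P? x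
... | yes p = mk↔ₛ′ (λ _ → zero) (λ _ → [ p ]) (λ { zero → refl }) (λ _ → refl)
... | no ¬p = mk↔ₛ′ (λ { [ p ] → ⊥-elim-irr (¬p p) }) (λ ())
                   (λ ()) (λ { [ p ] → ⊥-elim-irr (¬p p) })

Refinement↔filter : {P : Pred A 0ℓ} {xs : List A} → Enumeration xs → (P? : Decidable P) →
  [ a ∈ A ∣ P a ] ↔ Fin (length (filter P? xs))
Refinement↔filter {A} {P} {xs} enum P? =
  ↔-trans as-Σ (↔-trans (Σ↔sum enum _ (Irrelevant↔length-filter P?))
                        (Fin-cong (sym (length-filter≡sum P? xs))))
  where
  as-Σ : [ a ∈ A ∣ P a ] ↔ Σ A (Irrelevant ∘ P)
  as-Σ = mk↔ₛ′ (λ (a , p) → a , p) (λ (a , p) → a , p) (λ _ → refl) (λ _ → refl)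

Refinement-finite : {P : Pred (Vec (Fin m) s) 0ℓ} → Decidable P → Finite [ v ∈ Vec (Fin m) s ∣ P v ]
Refinement-finite P? = _ , Refinement↔filter (allVecs-enumeration _ _) P?

Refinement-cong : {P Q : Pred A 0ℓ} → (∀ {a} → P a → Q a) → (∀ {a} → Q a → P a) →
                  [ a ∈ A ∣ P a ] ↔ [ a ∈ A ∣ Q a ]
Refinement-cong P⇒Q Q⇒P = mk↔ₛ′ (refine P⇒Q) (refine Q⇒P) (λ _ → refl) (λ _ → refl)

Refinement-split : {P Q : Pred A 0ℓ} → Decidable Q →
  [ a ∈ A ∣ P a ] ↔ ([ a ∈ A ∣ P a × Q a ] ⊎ [ a ∈ A ∣ P a × ¬ Q a ])
Refinement-split {A} {P} {Q} Q? =
  mk↔ₛ′ (λ (a , [ p ]) → classify a p (Q? a)) from to∘from from∘to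
  where
  Split : Set
  Split = [ a ∈ A ∣ P a × Q a ] ⊎ [ a ∈ A ∣ P a × ¬ Q a ]
  classify : (a : A) → .(P a) → Dec (Q a) → Split
  classify a p (yes q) = inj₁ (a , [ p , q ])
  classify a p (no ¬q) = inj₂ (a , [ p , ¬q ])
  from : Split → [ a ∈ A ∣ P a ]
  from (inj₁ (a , pq)) = a , Irrelevant.map proj₁ pq
  from (inj₂ (a , pq)) = a , Irrelevant.map proj₁ pq
  to∘from : ∀ x → classify (value (from x)) _ (Q? (value (from x))) ≡ x
  to∘from (inj₁ (a , [ pq ])) = classify-yes (Q? a)
    where
    classify-yes : ∀ .{p} (d : Dec (Q a)) → classify a p d ≡ inj₁ (a , [ pq ])
    classify-yes (yes _) = refl
    classify-yes (no ¬q) = ⊥-elim-irr (¬q (proj₂ pq))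
  to∘from (inj₂ (a , [ pq ])) = classify-no (Q? a)
    where
    classify-no : ∀ .{p} (d : Dec (Q a)) → classify a p d ≡ inj₂ (a , [ pq ])
    classify-no (yes q) = ⊥-elim-irr (proj₂ pq q)
    classify-no (no _)  = refl
  from∘to : ∀ x → from (classify (value x) _ (Q? (value x))) ≡ x
  from∘to (a , _) with Q? a
  ... | yes _ = refl
  ... | no _  = refl

Refinement-partition : {P : Pred A 0ℓ} (c : A → C) → DecidableEquality C →
  [ a ∈ A ∣ P a ] ↔ Σ C (λ z → [ a ∈ A ∣ P a × c a ≡ z ])
Refinement-partition {A} {C} {P} c _≟_ = mk↔ₛ′
  (λ (a , p) → c a , a , Irrelevant.map (_, refl) p)
  (λ (_ , a , pe) → a , Irrelevant.map proj₁ pe)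
  (λ (z , a , [ pe ]) → same-class (recompute (c a ≟ z) (proj₂ pe)))
  (λ _ → refl)
  where
  same-class : ∀ {z a} .{pe pe'} → c a ≡ z →
    _≡_ {A = Σ C (λ z → [ a ∈ A ∣ P a × c a ≡ z ])} (c a , a , [ pe' ]) (z , a , [ pe ])
  same-class refl = refl

module _ {G H : Graph} where

  IsEmb-cong : {h h' : V G → V H} → h ≗ h' → IsEmb G H h → IsEmb G H h'
  IsEmb-cong h≗h' (inj , pres) =
    (λ x y eq → inj x y (trans (h≗h' x) (trans eq (sym (h≗h' y))))) ,
    (λ x y → trans (cong₂ (adj H) (sym (h≗h' x)) (sym (h≗h' y))) (pres x y))

  IsEmb⇒IsHom : {h : V G → V H} → IsEmb G H h → IsHom G H h
  IsEmb⇒IsHom (_ , pres) x y e = trans (pres x y) e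

  IsEmb-∘ : {K : Graph} {j : V H → V K} {h : V G → V H} →
            IsEmb H K j → IsEmb G H h → IsEmb G K (j ∘ h)
  IsEmb-∘ {K} {j} {h} j-emb h-emb = isEmb (_∘E_ {G} {H} {K} (mkEmb j j-emb) (mkEmb h h-emb))

  IsEmb-cancelˡ : {K : Graph} {j : V H → V K} {h : V G → V H} →
                  IsEmb H K j → IsEmb G K (j ∘ h) → IsEmb G H h
  IsEmb-cancelˡ {j = j} {h} (_ , j-pres) (inj , pres) =
    (λ x y eq → inj x y (cong j eq)) , (λ x y → trans (sym (j-pres (h x) (h y))) (pres x y))

  IsIso-inverse : {ψ : V G → V H} → IsIso G H ψ → Σ (V H → V G) (IsIso H G)
  IsIso-inverse {ψ} ((inj , pres) , surj) = σ , (σ-injective , σ-pres) , σ-surjective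
    where
    σ = proj₁ ∘ surj
    ψ∘σ : ∀ y → ψ (σ y) ≡ y
    ψ∘σ = proj₂ ∘ surj
    σ-injective : Injective σ
    σ-injective y y' eq = trans (sym (ψ∘σ y)) (trans (cong ψ eq) (ψ∘σ y'))
    σ-pres : ∀ a b → adj G (σ a) (σ b) ≡ adj H a b
    σ-pres a b = trans (sym (pres (σ a) (σ b))) (cong₂ (adj H) (ψ∘σ a) (ψ∘σ b))
    σ-surjective : Surjective σ
    σ-surjective x = ψ x , inj _ _ (ψ∘σ (ψ x))

adjacent? : (H : Graph) (x : V H) → Decidable (Edge H x)
adjacent? H x y = adj H x y Bool.≟ true

EdgeSet : Graph → Set
EdgeSet H = Σ (V H) λ x → [ y ∈ V H ∣ Edge H x y ]

EdgeSet-finite : (H : Graph) → Finite (EdgeSet H)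
EdgeSet-finite H =
  _ , Σ↔sum (allFin-enumeration (size H)) (λ x → length (filter (adjacent? H x) (List.allFin (size H))))
            (λ x → Refinement↔filter (allFin-enumeration (size H)) (adjacent? H x))

-- An injective endomorphism is injective on the finite edge set, hence onto it.
injective-endo-hom⇒emb : (H : Graph) (h : V H → V H) → IsHom H H h → Injective h → IsEmb H H h
injective-endo-hom⇒emb H h hom inj = inj , λ x y → ⇔→≡ (mk⇔ (reflects x y) (hom x y))
  where
  onEdges : EdgeSet H → EdgeSet H
  onEdges (x , y , e) = h x , h y , Irrelevant.map (hom x y) e
  onEdges-injective : Injective onEdges
  onEdges-injective (x , y , _) (x' , y' , _) eq with inj x x' (cong proj₁ eq)
  ... | refl = cong (x ,_) (value-injective (inj y y' (cong (value ∘ proj₂) eq)))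
  reflects : ∀ x y → Edge H (h x) (h y) → Edge H x y
  reflects x y e =
    preimage-edge (injective⇒surjective (EdgeSet-finite H) onEdges onEdges-injective (h x , h y , [ e ]))
    where
    preimage-edge : ∃[ ab ] onEdges ab ≡ (h x , h y , [ e ]) → Edge H x y
    preimage-edge ((a , ab) , eq) =
      subst₂ (Edge H) (inj a x (cong proj₁ eq)) (inj (value ab) y (cong (value ∘ proj₂) eq))
             (witness (adjacent? H a) ab)

-- With σ inverse to ψ, σ ∘ q is a vertex-surjective, hence injective, endomorphism of G.
surjective-hom⇒emb : {G H : Graph} {ψ q : V G → V H} →
  IsIso G H ψ → IsHom G H q → Surjective q → IsEmb G H q
surjective-hom⇒emb {G} {H} {q = q} ψ-iso q-hom q-surj =
  IsEmb-cancelˡ {G} {H} {G} σ-emb (injective-endo-hom⇒emb G (σ ∘ q) σ∘q-hom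
                         (Fin-surjective⇒injective (σ ∘ q) σ∘q-surjective))
  where
  inverse : Σ (V H → V G) (IsIso H G)
  inverse = IsIso-inverse {G} {H} ψ-iso
  σ : V H → V G
  σ = proj₁ inverse
  σ-emb : IsEmb H G σ
  σ-emb = proj₁ (proj₂ inverse)
  σ-surj : Surjective σ
  σ-surj = proj₂ (proj₂ inverse)
  σ∘q-hom : IsHom G G (σ ∘ q)
  σ∘q-hom x y e = IsEmb⇒IsHom {H} {G} σ-emb (q x) (q y) (q-hom x y e)
  σ∘q-surjective : Surjective (σ ∘ q)
  σ∘q-surjective x with σ-surj x
  ... | y , σy≡x with q-surj y
  ...   | z , refl = z , σy≡x

-- Profiles of maps into a graph

does-cong : {a? : Dec A} {b? : Dec B} → (A → B) → (B → A) → does a? ≡ does b?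
does-cong {a? = yes a} {yes b} _ _ = refl
does-cong {a? = yes a} {no ¬b} f _ = ⊥-elim (¬b (f a))
does-cong {a? = no ¬a} {yes b} _ g = ⊥-elim (¬a (g b))
does-cong {a? = no ¬a} {no ¬b} _ _ = refl

does-transport : {a? : Dec A} {b? : Dec B} → does a? ≡ does b? → A → B
does-transport {a? = yes _} {yes b} _  _ = b
does-transport {a? = no ¬a} {_}     _  a = ⊥-elim (¬a a)

Profile : ℕ → Set
Profile n = Vec (Vec (Bool × Bool) n) n

_≟ᴾ_ : DecidableEquality (Profile n)
_≟ᴾ_ = Vec.≡-dec (Vec.≡-dec (Product.≡-dec Bool._≟_ Bool._≟_))

module _ (H : Graph) where

  link : V H → V H → Bool × Bool
  link u v = does (u ≟ v) , adj H u v

  profile : (Fin n → V H) → Profile n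
  profile f = tabulate λ x → tabulate λ y → link (f x) (f y)

  profile-cong : {f f' : Fin n → V H} → f ≗ f' → profile f ≡ profile f'
  profile-cong f≗f' = tabulate-cong λ x → tabulate-cong λ y → cong₂ link (f≗f' x) (f≗f' y)

  profile-∘-emb : {K : Graph} {h h' : V K → V H} (c : Fin n → V K) →
                  IsEmb K H h → IsEmb K H h' → profile (h ∘ c) ≡ profile (h' ∘ c)
  profile-∘-emb {h = h} {h'} c (inj , pres) (inj' , pres') =
    tabulate-cong λ x → tabulate-cong λ y →
      cong₂ _,_ (does-cong {a? = h (c x) ≟ h (c y)} {b? = h' (c x) ≟ h' (c y)}
                           (cong h' ∘ inj (c x) (c y)) (cong h ∘ inj' (c x) (c y)))
                (trans (pres (c x) (c y)) (sym (pres' (c x) (c y))))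

  module _ {f f' : Fin n → V H} (same : profile f ≡ profile f') where

    private
      links : ∀ x y → link (f x) (f y) ≡ link (f' x) (f' y)
      links x y = trans (sym (entry f)) (trans (cong (λ P → lookup (lookup P x) y) same) (entry f'))
        where
        entry : (f : Fin n → V H) → lookup (lookup (profile f) x) y ≡ link (f x) (f y)
        entry f = trans (cong (λ row → lookup row y) (lookup∘tabulate _ x)) (lookup∘tabulate _ y)

    same-profile⇒kernel : ∀ {x y} → f x ≡ f y → f' x ≡ f' y
    same-profile⇒kernel {x} {y} =
      does-transport {a? = f x ≟ f y} {b? = f' x ≟ f' y} (cong proj₁ (links x y))

    same-profile⇒adj : ∀ x y → adj H (f x) (f y) ≡ adj H (f' x) (f' y)
    same-profile⇒adj x y = cong proj₂ (links x y)

  same-profile⇒emb : {K : Graph} {f f' : Fin n → V H} {c : V K → Fin n} →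
    profile f ≡ profile f' → IsEmb K H (f ∘ c) → IsEmb K H (f' ∘ c)
  same-profile⇒emb {c = c} same (inj , pres) =
    (λ x y eq → inj x y (same-profile⇒kernel (sym same) eq)) ,
    (λ x y → trans (sym (same-profile⇒adj same (c x) (c y))) (pres x y))

module Induced (H : Graph) {P : Pred (V H) 0ℓ} (P? : Decidable P) where

  members : [ x ∈ V H ∣ P x ] ↔ Fin (length (filter P? (List.allFin (size H))))
  members = Refinement↔filter (allFin-enumeration (size H)) P?

  inclusion : Fin (length (filter P? (List.allFin (size H)))) → V H
  inclusion = value ∘ Inverse.from members

  graph : Graph
  graph = record
    { size   = length (filter P? (List.allFin (size H)))
    ; adj    = λ a b → adj H (inclusion a) (inclusion b)
    ; sym    = λ a b → Graph.sym H (inclusion a) (inclusion b)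
    ; irrefl = λ a → irrefl H (inclusion a)
    }

  inclusion-emb : IsEmb graph H inclusion
  inclusion-emb = (λ a b eq → from-injective members (value-injective eq)) , (λ _ _ → refl)

  inclusion∘restrict : ∀ x (p : P x) → inclusion (Inverse.to members (x , [ p ])) ≡ x
  inclusion∘restrict x p = cong value (Inverse.strictlyInverseʳ members (x , [ p ]))

module Image (H : Graph) (f : Fin n → V H) where

  open Induced H (λ w → any? (λ x → f x ≟ w)) public

  corestrict : Fin n → V graph
  corestrict x = Inverse.to members (f x , [ x , refl ])

  inclusion∘corestrict : ∀ x → inclusion (corestrict x) ≡ f x
  inclusion∘corestrict x = inclusion∘restrict (f x) (x , refl)

  corestrict-surjective : Surjective corestrict
  corestrict-surjective a with witness (λ w → any? (λ x → f x ≟ w)) (Inverse.from members a)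
  ... | x , fx≡a = x , proj₁ inclusion-emb _ _ (trans (inclusion∘corestrict x) fx≡a)

  lift : V graph → Fin n
  lift = proj₁ ∘ corestrict-surjective

  corestrict∘lift : ∀ a → corestrict (lift a) ≡ a
  corestrict∘lift = proj₂ ∘ corestrict-surjective

  f∘lift : ∀ a → f (lift a) ≡ inclusion a
  f∘lift a = trans (sym (inclusion∘corestrict (lift a))) (cong inclusion (corestrict∘lift a))

  module _ {g : Fin n → V H} (same : profile H g ≡ profile H f) where

    same-profile⇒factor-emb : IsEmb graph H (g ∘ lift)
    same-profile⇒factor-emb =
      same-profile⇒emb H {K = graph} {c = lift} (sym same)
        (IsEmb-cong {graph} {H} (sym ∘ f∘lift) inclusion-emb)

    same-profile⇒factorises : ∀ x → g (lift (corestrict x)) ≡ g x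
    same-profile⇒factorises x =
      same-profile⇒kernel H (sym same) (trans (f∘lift (corestrict x)) (inclusion∘corestrict x))

  emb∘corestrict-profile : {h : V graph → V H} → IsEmb graph H h →
                           profile H (h ∘ corestrict) ≡ profile H f
  emb∘corestrict-profile h-emb =
    trans (profile-∘-emb H {K = graph} corestrict h-emb inclusion-emb)
          (profile-cong H inclusion∘corestrict)

module FreeSum {T₁ T₂ : GraphType} {e : Emb (Δ T₂) (Θ T₁)} {Λ : Graph}
               {λ₁ : Emb (Θ T₁) Λ} {λ₂ : Emb (Θ T₂) Λ}
               (FS : IsFreeSum T₁ T₂ e Λ λ₁ λ₂) where

  open IsFreeSum FS

  copair : (V (Θ T₁) → A) → (V (Θ T₂) → A) → V Λ → A
  copair h₁ h₂ z with covers z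
  ... | inj₁ (x , _) = h₁ x
  ... | inj₂ (y , _) = h₂ y

  copair-unique : {h₁ : V (Θ T₁) → A} {h₂ : V (Θ T₂) → A} (h : V Λ → A) →
                  h₁ ≗ h ∘ fun λ₁ → h₂ ≗ h ∘ fun λ₂ → copair h₁ h₂ ≗ h
  copair-unique h h₁≗ h₂≗ z with covers z
  ... | inj₁ (x , λ₁x≡z) = trans (h₁≗ x) (cong h λ₁x≡z)
  ... | inj₂ (y , λ₂y≡z) = trans (h₂≗ y) (cong h λ₂y≡z)

  module _ (h₁ : V (Θ T₁) → A) (h₂ : V (Θ T₂) → A)
           (agree : ∀ v → h₂ (fun (ι T₂) v) ≡ h₁ (fun e v)) where

    copair-λ₁ : ∀ x → copair h₁ h₂ (fun λ₁ x) ≡ h₁ x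
    copair-λ₁ x with covers (fun λ₁ x)
    ... | inj₁ (x' , eq) = cong h₁ (proj₁ (isEmb λ₁) x' x eq)
    ... | inj₂ (y , eq) with glueOnly x y (sym eq)
    ...   | v , refl , refl = agree v

    copair-λ₂ : ∀ y → copair h₁ h₂ (fun λ₂ y) ≡ h₂ y
    copair-λ₂ y with covers (fun λ₂ y)
    ... | inj₂ (y' , eq) = cong h₂ (proj₁ (isEmb λ₂) y' y eq)
    ... | inj₁ (x , eq) with glueOnly x y eq
    ...   | v , refl , refl = sym (agree v)

  hom-from-parts : {Γ : Graph} {h : V Λ → V Γ} →
    IsHom (Θ T₁) Γ (h ∘ fun λ₁) → IsHom (Θ T₂) Γ (h ∘ fun λ₂) → IsHom Λ Γ h
  hom-from-parts hom₁ hom₂ a b ab with Equivalence.to (edges a b) ab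
  ... | inj₁ (x , x' , xx' , refl , refl) = hom₁ x x' xx'
  ... | inj₂ (y , y' , yy' , refl , refl) = hom₂ y y' yy'

Extension : (Γ : Graph) (T : GraphType) → Emb (Δ T) Γ → Set
Extension Γ T κ = [ v ∈ Vec (V Γ) (size (Θ T)) ∣ Extends Γ T κ (lookup v) ]

Extension↔count : (Γ : Graph) (T : GraphType) (κ : Emb (Δ T) Γ) →
                  Extension Γ T κ ↔ Fin (count Γ T κ)
Extension↔count Γ T κ =
  Refinement↔filter (allVecs-enumeration _ _) (λ v → extends? Γ T κ (lookup v))

extension-witness : (Γ : Graph) (T : GraphType) (κ : Emb (Δ T) Γ) (x : Extension Γ T κ) →
                    Extends Γ T κ (lookup (value x))
extension-witness Γ T κ = witness (λ v → extends? Γ T κ (lookup v))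

regular⇒extensions-equinumerous : (Γ : Graph) (T : GraphType) → Regular Γ T →
  ∀ κ κ' → Extension Γ T κ ↔ Extension Γ T κ'
regular⇒extensions-equinumerous Γ T regular κ κ' =
  ↔-trans (Extension↔count Γ T κ)
          (↔-trans (Fin-cong (regular κ κ')) (↔-sym (Extension↔count Γ T κ')))

Extends-cong : {Γ : Graph} {T : GraphType} {κ : Emb (Δ T) Γ} {h h' : V (Θ T) → V Γ} →
               h ≗ h' → Extends Γ T κ h → Extends Γ T κ h'
Extends-cong {Γ} {T} h≗h' (emb , ext) =
  IsEmb-cong {Θ T} {Γ} h≗h' emb , λ v → trans (sym (h≗h' _)) (ext v)

-- Maps from the free sum into Γ

module Gluing (Γ : Graph) {T₁ T₂ : GraphType} {e : Emb (Δ T₂) (Θ T₁)} {Λ : Graph}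
              {λ₁ : Emb (Θ T₁) Λ} {λ₂ : Emb (Θ T₂) Λ}
              (FS : IsFreeSum T₁ T₂ e Λ λ₁ λ₂) where

  open FreeSum FS
  open IsFreeSum FS using (glue)

  T₊ : GraphType
  T₊ = freeSumType T₁ Λ λ₁

  Map : Set
  Map = Vec (V Γ) (size Λ)

  Glues : Emb (Δ T₁) Γ → Pred Map 0ℓ
  Glues κ g = Extends Γ T₁ κ (lookup g ∘ fun λ₁) × IsEmb (Θ T₂) Γ (lookup g ∘ fun λ₂)

  glues? : (κ : Emb (Δ T₁) Γ) → Decidable (Glues κ)
  glues? κ g =
    extends? Γ T₁ κ (lookup g ∘ fun λ₁) ×-dec isEmb? (Θ T₂) Γ (lookup g ∘ fun λ₂)

  Gluing : Emb (Δ T₁) Γ → Set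
  Gluing κ = [ g ∈ Map ∣ Glues κ g ]

  along-e : (κ : Emb (Δ T₁) Γ) → Extension Γ T₁ κ → Emb (Δ T₂) Γ
  along-e κ h = mkEmb (lookup (value h)) (proj₁ (extension-witness Γ T₁ κ h)) ∘E e

  Pair : Emb (Δ T₁) Γ → Set
  Pair κ = Σ (Extension Γ T₁ κ) (λ h → Extension Γ T₂ (along-e κ h))

  module Glued {κ : Emb (Δ T₁) Γ} (p : Pair κ) where

    h₁ = value (proj₁ p)
    h₂ = value (proj₂ p)

    glued : Map
    glued = tabulate (copair (lookup h₁) (lookup h₂))

    private
      agree = proj₂ (extension-witness Γ T₂ (along-e κ (proj₁ p)) (proj₂ p))

    glued-λ₁ : lookup glued ∘ fun λ₁ ≗ lookup h₁
    glued-λ₁ x =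
      trans (lookup∘tabulate _ (fun λ₁ x)) (copair-λ₁ (lookup h₁) (lookup h₂) agree x)

    glued-λ₂ : lookup glued ∘ fun λ₂ ≗ lookup h₂
    glued-λ₂ y =
      trans (lookup∘tabulate _ (fun λ₂ y)) (copair-λ₂ (lookup h₁) (lookup h₂) agree y)

  gluing↔pair : ∀ κ → Gluing κ ↔ Pair κ
  gluing↔pair κ = mk↔ₛ′ split join split∘join join∘split
    where
    split : Gluing κ → Pair κ
    split (g , gl) =
      (tabulate (lookup g ∘ fun λ₁) ,
       Irrelevant.map (Extends-cong {Γ} {T₁} {κ} on-Θ₁ ∘ proj₁) gl) ,
      (tabulate (lookup g ∘ fun λ₂) ,
       Irrelevant.map (λ w → IsEmb-cong {Θ T₂} {Γ} on-Θ₂ (proj₂ w) , agree) gl)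
      where
      on-Θ₁ : lookup g ∘ fun λ₁ ≗ lookup (tabulate (lookup g ∘ fun λ₁))
      on-Θ₁ = sym ∘ lookup∘tabulate _
      on-Θ₂ : lookup g ∘ fun λ₂ ≗ lookup (tabulate (lookup g ∘ fun λ₂))
      on-Θ₂ = sym ∘ lookup∘tabulate _
      agree : ∀ v → lookup (tabulate (lookup g ∘ fun λ₂)) (fun (ι T₂) v)
                  ≡ lookup (tabulate (lookup g ∘ fun λ₁)) (fun e v)
      agree v = trans (sym (on-Θ₂ (fun (ι T₂) v)))
                      (trans (cong (lookup g) (sym (glue v))) (on-Θ₁ (fun e v)))
    join : Pair κ → Gluing κ
    join p@(x₁ , x₂) =
      glued , [ Extends-cong {Γ} {T₁} {κ} (sym ∘ glued-λ₁) (extension-witness Γ T₁ κ x₁) ,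
                IsEmb-cong {Θ T₂} {Γ} (sym ∘ glued-λ₂)
                           (proj₁ (extension-witness Γ T₂ (along-e κ x₁) x₂)) ]
      where open Glued {κ} p
    pair-≡ : {h h' : Extension Γ T₁ κ}
             {k : Extension Γ T₂ (along-e κ h)} {k' : Extension Γ T₂ (along-e κ h')} →
             value h ≡ value h' → value k ≡ value k' → _≡_ {A = Pair κ} (h , k) (h' , k')
    pair-≡ {_ , _} {_ , _} {_ , _} {_ , _} refl refl = refl
    split∘join : ∀ p → split (join p) ≡ p
    split∘join p = pair-≡ (trans (tabulate-cong glued-λ₁) (tabulate∘lookup h₁))
                          (trans (tabulate-cong glued-λ₂) (tabulate∘lookup h₂))
      where open Glued {κ} p
    join∘split : ∀ g → join (split g) ≡ g
    join∘split (g , _) =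
      value-injective
        (trans (tabulate-cong (copair-unique (lookup g) (lookup∘tabulate _) (lookup∘tabulate _)))
               (tabulate∘lookup g))

  gluings-equinumerous : Regular Γ T₁ → Regular Γ T₂ → ∀ κ κ' → Gluing κ ↔ Gluing κ'
  gluings-equinumerous R₁ R₂ κ κ' = begin
    Gluing κ  ↔⟨ gluing↔pair κ ⟩
    Pair κ    ↔⟨ Σ-↔ extensions₁ (λ {h} → extensions₂ (along-e κ h)
                                                     (along-e κ' (Inverse.to extensions₁ h))) ⟩
    Pair κ'   ↔⟨ gluing↔pair κ' ⟨
    Gluing κ' ∎
    where
    open Related.EquationalReasoning
    extensions₁ = regular⇒extensions-equinumerous Γ T₁ R₁ κ κ'
    extensions₂ = regular⇒extensions-equinumerous Γ T₂ R₂

  Degenerate : Emb (Δ T₁) Γ → Pred Map 0ℓ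
  Degenerate κ g = Glues κ g × ¬ IsEmb Λ Γ (lookup g)

  degenerate? : (κ : Emb (Δ T₁) Γ) → Decidable (Degenerate κ)
  degenerate? κ g = glues? κ g ×-dec ¬? (isEmb? Λ Γ (lookup g))

  DegenerateGluing : Emb (Δ T₁) Γ → Set
  DegenerateGluing κ = [ g ∈ Map ∣ Degenerate κ g ]

  gluing↔extension⊎degenerate : ∀ κ → Gluing κ ↔ (Extension Γ T₊ κ ⊎ DegenerateGluing κ)
  gluing↔extension⊎degenerate κ =
    ↔-trans (Refinement-split (λ g → isEmb? Λ Γ (lookup g)))
            (Refinement-cong (λ ((ext₁ , _) , emb) → emb , proj₂ ext₁)
                             (λ (emb , ext) → ((IsEmb-∘ {Θ T₁} {Λ} {Γ} emb (isEmb λ₁) , ext) ,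
                                               IsEmb-∘ {Θ T₂} {Λ} {Γ} emb (isEmb λ₂)) , emb)
             ⊎-↔ ↔-refl)

  Fibre : Profile (size Λ) → Emb (Δ T₁) Γ → Set
  Fibre P κ = [ g ∈ Map ∣ Degenerate κ g × profile Γ (lookup g) ≡ P ]

  fibre? : (P : Profile (size Λ)) (κ : Emb (Δ T₁) Γ) →
           Decidable (λ g → Degenerate κ g × profile Γ (lookup g) ≡ P)
  fibre? P κ g = degenerate? κ g ×-dec (profile Γ (lookup g) ≟ᴾ P)

  module Member {P : Profile (size Λ)} {κ : Emb (Δ T₁) Γ} (x : Fibre P κ) where

    private
      w = witness (fibre? P κ) x

    extends₁ : Extends Γ T₁ κ (lookup (value x) ∘ fun λ₁)
    extends₁ = proj₁ (proj₁ (proj₁ w))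

    embeds₂ : IsEmb (Θ T₂) Γ (lookup (value x) ∘ fun λ₂)
    embeds₂ = proj₂ (proj₁ (proj₁ w))

    not-embedding : ¬ IsEmb Λ Γ (lookup (value x))
    not-embedding = proj₂ (proj₁ w)

    has-profile : profile Γ (lookup (value x)) ≡ P
    has-profile = proj₂ w

  module Quotient {P : Profile (size Λ)} {κ₀ : Emb (Δ T₁) Γ} (x₀ : Fibre P κ₀) where

    f₀ : V Λ → V Γ
    f₀ = lookup (value x₀)

    open Member {P} {κ₀} x₀
      renaming (extends₁ to ext₀; embeds₂ to emb₀; not-embedding to ¬emb₀; has-profile to profile₀)

    open Image Γ f₀

    ι₀ : Emb (Δ T₁) graph
    ι₀ = mkEmb (corestrict ∘ fun λ₁ ∘ fun (ι T₁))
               (IsEmb-cancelˡ {Δ T₁} {graph} {Γ} inclusion-emb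
                  (IsEmb-cong {Δ T₁} {Γ} (λ v → sym (trans (inclusion∘corestrict _) (proj₂ ext₀ v)))
                              (isEmb κ₀)))

    T₀ : GraphType
    T₀ = mkType (Δ T₁) graph ι₀

    corestrict-hom : IsHom Λ graph corestrict
    corestrict-hom a b ab =
      trans (cong₂ (adj Γ) (inclusion∘corestrict a) (inclusion∘corestrict b))
            (hom-from-parts {Γ} (IsEmb⇒IsHom {Θ T₁} {Γ} (proj₁ ext₀)) (IsEmb⇒IsHom {Θ T₂} {Γ} emb₀)
                            a b ab)

    T₀≺T₊ : T₀ ≺ T₊
    T₀≺T₊ = (quotient , id-iso , corestrict-surjective) , not-iso
      where
      quotient : Morphism T₊ T₀
      quotient = record
        { f = id ; g = corestrict ; fHom = λ _ _ e → e ; gHom = corestrict-hom ; comm = λ _ → refl }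
      id-iso : IsIso (Δ T₁) (Δ T₁) id
      id-iso = ((λ _ _ eq → eq) , (λ _ _ → refl)) , (λ y → y , refl)
      not-iso : ¬ Σ (Morphism T₊ T₀) (λ m → IsIso (Δ T₁) (Δ T₁) (f m) × IsIso Λ graph (g m))
      not-iso (_ , _ , iso) =
        ¬emb₀ (IsEmb-cong {Λ} {Γ} inclusion∘corestrict
                 (IsEmb-∘ {Λ} {graph} {Γ} inclusion-emb
                    (surjective-hom⇒emb {Λ} {graph} iso corestrict-hom corestrict-surjective)))

    fibre↔extension : ∀ κ → Fibre P κ ↔ Extension Γ T₀ κ
    fibre↔extension κ = mk↔ₛ′ to from to∘from from∘to
      where
      same-as-f₀ : (x : Fibre P κ) → profile Γ (lookup (value x)) ≡ profile Γ f₀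
      same-as-f₀ x = trans (Member.has-profile {P} {κ} x) (sym profile₀)
      to : Fibre P κ → Extension Γ T₀ κ
      to x = tabulate g′ ,
             [ IsEmb-cong {graph} {Γ} (sym ∘ lookup∘tabulate g′)
                          (same-profile⇒factor-emb (same-as-f₀ x)) ,
               (λ v → trans (lookup∘tabulate g′ (fun ι₀ v))
                            (trans (same-profile⇒factorises (same-as-f₀ x) _)
                                   (proj₂ (Member.extends₁ {P} {κ} x) v))) ]
        where
        g′ : V graph → V Γ
        g′ = lookup (value x) ∘ lift
      from : Extension Γ T₀ κ → Fibre P κ
      from y = tabulate h′ ,
               [ (((same-profile⇒emb Γ {K = Θ T₁} {c = fun λ₁} (sym same) (proj₁ ext₀) , ext) ,
                   same-profile⇒emb Γ {K = Θ T₂} {c = fun λ₂} (sym same) emb₀) ,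
                  (λ emb → ¬emb₀ (same-profile⇒emb Γ {K = Λ} {c = id} same emb))) ,
                 trans same profile₀ ]
        where
        h′ : V Λ → V Γ
        h′ = lookup (value y) ∘ corestrict
        h-ext = extension-witness Γ T₀ κ y
        same : profile Γ (lookup (tabulate h′)) ≡ profile Γ f₀
        same = trans (profile-cong Γ (lookup∘tabulate h′)) (emb∘corestrict-profile (proj₁ h-ext))
        ext : ∀ v → lookup (tabulate h′) (fun λ₁ (fun (ι T₁) v)) ≡ fun κ v
        ext v = trans (lookup∘tabulate h′ (fun λ₁ (fun (ι T₁) v))) (proj₂ h-ext v)
      to∘from : ∀ y → to (from y) ≡ y
      to∘from (h , _) =
        value-injective
          (trans (tabulate-cong λ a → trans (lookup∘tabulate (lookup h ∘ corestrict) (lift a))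
                                            (cong (lookup h) (corestrict∘lift a)))
                 (tabulate∘lookup h))
      from∘to : ∀ x → from (to x) ≡ x
      from∘to x =
        value-injective
          (trans (tabulate-cong λ a → trans (lookup∘tabulate (lookup (value x) ∘ lift) (corestrict a))
                                            (same-profile⇒factorises (same-as-f₀ x) a))
                 (tabulate∘lookup (value x)))

  fibres-equinumerous : (∀ T → T ≺ T₊ → Regular Γ T) →
                        ∀ P κ κ' → Fibre P κ ↔ Fibre P κ'
  fibres-equinumerous R≺ P κ κ' =
    ↔-by-witness (inhabited? (proj₂ (Refinement-finite (fibre? P κ))))
                 (inhabited? (proj₂ (Refinement-finite (fibre? P κ'))))
      λ { (inj₁ x) → via {κ} x ; (inj₂ x) → via {κ'} x }
    where
    via : ∀ {κ₀} → Fibre P κ₀ → Fibre P κ ↔ Fibre P κ'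
    via {κ₀} x₀ =
      ↔-trans (fibre↔extension κ)
              (↔-trans (regular⇒extensions-equinumerous Γ T₀ (R≺ T₀ T₀≺T₊) κ κ')
                       (↔-sym (fibre↔extension κ')))
      where open Quotient {P} {κ₀} x₀

  degenerates-equinumerous : (∀ T → T ≺ T₊ → Regular Γ T) →
                             ∀ κ κ' → DegenerateGluing κ ↔ DegenerateGluing κ'
  degenerates-equinumerous R≺ κ κ' =
    ↔-trans (Refinement-partition (profile Γ ∘ lookup) _≟ᴾ_)
      (↔-trans (Σ-↔ ↔-refl (fibres-equinumerous R≺ _ κ κ'))
               (↔-sym (Refinement-partition (profile Γ ∘ lookup) _≟ᴾ_)))

mainTheorem3 : (Γ : Graph) (T₁ T₂ : GraphType) (e : Emb (Δ T₂) (Θ T₁))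
               (Λ : Graph) (λ₁ : Emb (Θ T₁) Λ) (λ₂ : Emb (Θ T₂) Λ) →
               IsFreeSum T₁ T₂ e Λ λ₁ λ₂ →
               Regular Γ T₁ →
               Regular Γ T₂ →
               (∀ (T : GraphType) → T ≺ freeSumType T₁ Λ λ₁ → Regular Γ T) →
               Regular Γ (freeSumType T₁ Λ λ₁)
mainTheorem3 Γ T₁ T₂ e Λ λ₁ λ₂ FS R₁ R₂ R≺ κ κ' =
  ⊎-cancelʳ-Fin counts (Refinement-finite (degenerate? κ))
  where
  open Gluing Γ FS
  open Related.EquationalReasoning
  counts : (Fin (count Γ T₊ κ) ⊎ DegenerateGluing κ) ↔ (Fin (count Γ T₊ κ') ⊎ DegenerateGluing κ)
  counts = begin
    (Fin (count Γ T₊ κ) ⊎ DegenerateGluing κ)   ↔⟨ Extension↔count Γ T₊ κ ⊎-↔ ↔-refl ⟨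
    (Extension Γ T₊ κ ⊎ DegenerateGluing κ)     ↔⟨ gluing↔extension⊎degenerate κ ⟨
    Gluing κ                                    ↔⟨ gluings-equinumerous R₁ R₂ κ κ' ⟩
    Gluing κ'                                   ↔⟨ gluing↔extension⊎degenerate κ' ⟩
    (Extension Γ T₊ κ' ⊎ DegenerateGluing κ')   ↔⟨ Extension↔count Γ T₊ κ' ⊎-↔
                                                   degenerates-equinumerous R≺ κ' κ ⟩
    (Fin (count Γ T₊ κ') ⊎ DegenerateGluing κ)  ∎
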